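{- Let $Q_1$ be a quiver on vertex set $[N_1]$ and $Q_2$ a quiver on vertex set $[N_1+1,N_1+N_2]$. Fix a vertex $a\in (Q_1)_0$ and pairwise distinct vertices $b_1,\dots,b_r\in (Q_2)_0$, and let $Q=Q_1\oplus_{(a,\dots,a)}^{(b_1,\dots,b_r)}Q_2$. Let $\underline{\mu}=\mu_{i_d}\circ\cdots\circ\mu_{i_1}$ be a mutation sequence with every $i_j\in (Q_1)_0$, let $Q^{(0)}=\widehat{Q}$ and $Q^{(k)}=(\mu_{i_k}\circ\cdots\circ\mu_{i_1})(\widehat{Q})$ for $1\le k\le d$. For vertices $x,y$ put $\alpha(x,y,k)=\#\{\text{arrows }x\to y\text{ in }Q^{(k)}\}-\#\{\text{arrows }y\to x\text{ in }Q^{(k)}\}$. Then for every $k\in[0,d]$ and every $x\in (Q_1)_0$ we have $\alpha(x,b_i,k)=\alpha(x,b_j,k)$ for all $i,j\in[r]$.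
   Context: A quiver is a finite directed graph with no loops and no 2-cycles. Mutation $\mu_k$ at a (non-frozen) vertex $k$: for each 2-path $i\to k\to j$ add an arrow $i\to j$, reverse all arrows incident to $k$, then delete 2-cycles. Mutation sequences are applied right to left. For a quiver $Q$ on vertices $[N]$, the framed quiver $\widehat{Q}$ is obtained by adjoining frozen vertices $1',\dots,N'$ and arrows $i\to i'$; frozen vertices are never mutated. Direct sum: given a quiver $Q_1$ on $[N_1]$, a quiver $Q_2$ on $[N_1+1,N_1+N_2]$, an ordered $k$-multiset $(a_1,\dots,a_k)$ of vertices of $Q_1$ and a $k$-multiset $(b_1,\dots,b_k)$ of vertices of $Q_2$, the quiver $Q_1\oplus_{(a_1,\dots,a_k)}^{(b_1,\dots,b_k)}Q_2$ has vertex set $[N_1+N_2]$ and arrows those of $Q_1$, those of $Q_2$, and one arrow $a_i\to b_i$ for each $i\in[k]$. -}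

module Defs where

open import Data.Nat using (ℕ; zero; suc; _+_; _*_; _∸_)
open import Data.Integer using (ℤ; +_; _-_)
open import Data.Fin using (Fin; zero; suc; splitAt; _↑ˡ_; _↑ʳ_)
open import Data.Fin.Properties using (_≟_)
open import Data.Sum using (_⊎_; inj₁; inj₂)
open import Data.Bool using (Bool; true; false; if_then_else_; _∧_)
open import Data.List using (List; []; _∷_; foldl; take)
open import Relation.Nullary.Decidable using (⌊_⌋)
open import Relation.Binary.PropositionalEquality using (_≡_)

-- A quiver on vertex set Fin n, given by its arrow-multiplicity function:
-- Arrows n i j = number of arrows i → j.
Arrows : ℕ → Set
Arrows n = Fin n → Fin n → ℕ

IsQuiver : ∀ {n} → Arrows n → Set
IsQuiver {n} Q = (∀ i → Q i i ≡ 0) × (∀ i j → Q i j ≡ 0 ⊎ Q j i ≡ 0)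
  where open import Data.Product using (_×_)

countFin : ∀ {r} → (Fin r → Bool) → ℕ
countFin {zero} p = 0
countFin {suc r} p = (if p zero then 1 else 0) + countFin (λ i → p (suc i))

-- Mutation at vertex k, performed literally:
--  (1) for each 2-path i → k → j (i, j ≠ k) add an arrow i → j,
--  (2) reverse all arrows incident to k,
--  (3) delete 2-cycles (cancel pairs of opposite arrows).
step12 : ∀ {n} → Fin n → Arrows n → Arrows n
step12 k Q i j with ⌊ i ≟ k ⌋ | ⌊ j ≟ k ⌋
... | true  | _     = Q j i
... | false | true  = Q j i
... | false | false = Q i j + Q i k * Q k j

mutate : ∀ {n} → Fin n → Arrows n → Arrows n
mutate k Q i j = step12 k Q i j ∸ step12 k Q j i

-- A mutation sequence given as the list [i₁, …, i_d], applied i₁ first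
-- (i.e. μ_{i_d} ∘ ⋯ ∘ μ_{i₁}).
mutateSeq : ∀ {n} → List (Fin n) → Arrows n → Arrows n
mutateSeq ks Q = foldl (λ R k → mutate k R) Q ks

-- Framed quiver: vertices Fin (N + N); i ↑ˡ N is the original vertex i,
-- N ↑ʳ i is the frozen vertex i'. Arrows i → i' are added.
framed : ∀ {N} → Arrows N → Arrows (N + N)
framed {N} Q x y with splitAt N x | splitAt N y
... | inj₁ i | inj₁ j = Q i j
... | inj₁ i | inj₂ j = if ⌊ i ≟ j ⌋ then 1 else 0
... | inj₂ _ | _      = 0

-- Direct sum Q₁ ⊕_{(a₁..a_r)}^{(b₁..b_r)} Q₂ on Fin (N₁ + N₂):
-- vertex i of Q₁ is i ↑ˡ N₂, vertex j of Q₂ is N₁ ↑ʳ j (i.e. N₁ + j).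
directSum : ∀ {N₁ N₂ r} → Arrows N₁ → Arrows N₂ →
            (Fin r → Fin N₁) → (Fin r → Fin N₂) → Arrows (N₁ + N₂)
directSum {N₁} Q₁ Q₂ a b x y with splitAt N₁ x | splitAt N₁ y
... | inj₁ i | inj₁ j = Q₁ i j
... | inj₂ i | inj₂ j = Q₂ i j
... | inj₁ i | inj₂ j = countFin (λ t → ⌊ a t ≟ i ⌋ ∧ ⌊ b t ≟ j ⌋)
... | inj₂ _ | inj₁ _ = 0

α : ∀ {n} → Arrows n → Fin n → Fin n → ℤ
α Q x y = + Q x y - + Q y x

module Submission where

-- Call two vertices p, q of a quiver R *twins relative to* a
-- vertex set S when every u ∈ S sees them alike: R u p ≡ R u q and
-- R p u ≡ R q u.  Mutation at a vertex k ∈ S distinct from p and q changes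
-- arrow counts only through 2-paths passing through k, and those look the
-- same from p and from q; so it preserves twinship relative to S, and so does
-- any sequence of such mutations.  In the direct sum Q₁ ⊕ Q₂ glued along the
-- single vertex a, the vertices b_i are twins relative to Q₁ (each receives
-- exactly one arrow from a and nothing else from Q₁); framing keeps them
-- twins relative to Q₁ together with its frozen copies.  Since the
-- mutations only use vertices of Q₁, twinship survives, and α(x, b_i) is
-- determined by the arrow counts between x and b_i.

open import Defs
open import Data.Nat using (ℕ; _+_; _*_; _∸_; _≤_; zero; suc)
open import Data.Integer using (+_; _-_)
open import Data.Fin using (Fin; _↑ˡ_; _↑ʳ_; zero; suc; splitAt)
open import Data.Fin.Properties using (_≟_; ↑ˡ-injective; splitAt-↑ˡ; splitAt-↑ʳ)
open import Data.List using (List; length; map; take; _∷_)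
open import Data.List.Relation.Unary.All using (All; []; _∷_; universal)
open import Data.List.Relation.Unary.All.Properties using (map⁺)
open import Data.Bool using (Bool; true; false; if_then_else_; _∧_)
open import Data.Sum using (_⊎_; inj₁; inj₂)
open import Data.Product using (Σ; _×_; _,_; proj₁; proj₂)
open import Data.Empty using (⊥-elim)
open import Relation.Nullary using (yes; no)
open import Relation.Nullary.Decidable using (⌊_⌋; ⌊⌋-map′)
open import Function.Definitions using (Injective)
open import Relation.Binary.PropositionalEquality
  using (_≡_; _≢_; refl; sym; trans; cong; cong₂)

countFin-cong : ∀ {r} (f g : Fin r → Bool) → (∀ t → f t ≡ g t) → countFin f ≡ countFin g
countFin-cong {zero}  f g f≗g = refl
countFin-cong {suc r} f g f≗g =
  cong₂ _+_ (cong (λ c → if c then 1 else 0) (f≗g zero))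
            (countFin-cong (λ t → f (suc t)) (λ t → g (suc t)) (λ t → f≗g (suc t)))

countFin-false : ∀ r → countFin {r} (λ _ → false) ≡ 0
countFin-false zero    = refl
countFin-false (suc r) = countFin-false r

countFin-∧ : ∀ {r} (c : Bool) (f : Fin r → Bool) →
  countFin (λ t → c ∧ f t) ≡ (if c then countFin f else 0)
countFin-∧     true  f = refl
countFin-∧ {r} false f = countFin-false r

countFin-≡ : ∀ {r} (i : Fin r) → countFin (λ t → ⌊ t ≟ i ⌋) ≡ 1
countFin-≡ {suc r} zero    = cong suc (countFin-false r)
countFin-≡ {suc r} (suc i) =
  trans (countFin-cong _ _ (λ t → ⌊⌋-map′ (cong suc) _ (t ≟ i))) (countFin-≡ i)

countFin-injective : ∀ {r m} (b : Fin r → Fin m) → Injective _≡_ _≡_ b →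
  (i : Fin r) → countFin (λ t → ⌊ b t ≟ b i ⌋) ≡ 1
countFin-injective b inj i = trans (countFin-cong _ _ same-test) (countFin-≡ i)
  where
  same-test : ∀ t → ⌊ b t ≟ b i ⌋ ≡ ⌊ t ≟ i ⌋
  same-test t with b t ≟ b i | t ≟ i
  ... | yes _     | yes _    = refl
  ... | no  _     | no  _    = refl
  ... | yes bt≡bi | no  t≢i  = ⊥-elim (t≢i (inj bt≡bi))
  ... | no  bt≢bi | yes t≡i  = ⊥-elim (bt≢bi (cong b t≡i))

↑ˡ≢↑ʳ : ∀ {m n} (i : Fin m) (j : Fin n) → i ↑ˡ n ≢ m ↑ʳ j
↑ˡ≢↑ʳ {m} {n} i j e
  with () ← trans (sym (splitAt-↑ˡ m i n)) (trans (cong (splitAt m) e) (splitAt-↑ʳ m n j))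

module _ {N : ℕ} (Q : Arrows N) where
  framed-↑ˡ-↑ˡ : ∀ x y → framed Q (x ↑ˡ N) (y ↑ˡ N) ≡ Q x y
  framed-↑ˡ-↑ˡ x y rewrite splitAt-↑ˡ N x N | splitAt-↑ˡ N y N = refl

  framed-↑ˡ-↑ʳ : ∀ x y → x ≢ y → framed Q (x ↑ˡ N) (N ↑ʳ y) ≡ 0
  framed-↑ˡ-↑ʳ x y x≢y rewrite splitAt-↑ˡ N x N | splitAt-↑ʳ N N y with x ≟ y
  ... | yes x≡y = ⊥-elim (x≢y x≡y)
  ... | no  _   = refl

  framed-↑ʳ : ∀ x y → framed Q (N ↑ʳ x) y ≡ 0
  framed-↑ʳ x y rewrite splitAt-↑ʳ N N x = refl

module _ {N₁ N₂ r : ℕ} (Q₁ : Arrows N₁) (Q₂ : Arrows N₂)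
         (a : Fin r → Fin N₁) (b : Fin r → Fin N₂) where
  directSum-↑ˡ-↑ʳ : ∀ x y →
    directSum Q₁ Q₂ a b (x ↑ˡ N₂) (N₁ ↑ʳ y) ≡ countFin (λ t → ⌊ a t ≟ x ⌋ ∧ ⌊ b t ≟ y ⌋)
  directSum-↑ˡ-↑ʳ x y rewrite splitAt-↑ˡ N₁ x N₂ | splitAt-↑ʳ N₁ N₂ y = refl

  directSum-↑ʳ-↑ˡ : ∀ x y → directSum Q₁ Q₂ a b (N₁ ↑ʳ x) (y ↑ˡ N₂) ≡ 0
  directSum-↑ʳ-↑ˡ x y rewrite splitAt-↑ˡ N₁ y N₂ | splitAt-↑ʳ N₁ N₂ x = refl

Twins : ∀ {n} → (Fin n → Set) → Arrows n → Fin n → Fin n → Set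
Twins S R p q = ∀ u → S u → (R u p ≡ R u q) × (R p u ≡ R q u)

Avoids : ∀ {n} → (Fin n → Set) → Fin n → Fin n → Set
Avoids S p q = ∀ u → S u → (p ≢ u) × (q ≢ u)

twins-α : ∀ {n} {S : Fin n → Set} {R : Arrows n} {p q : Fin n} →
  Twins S R p q → ∀ u → S u → α R u p ≡ α R u q
twins-α tw u Su = cong₂ (λ m n → + m - + n) (proj₁ (tw u Su)) (proj₂ (tw u Su))

module _ {n : ℕ} {S : Fin n → Set} {R : Arrows n} {p q k : Fin n}
         (tw : Twins S R p q) (Sk : S k) (p≢k : p ≢ k) (q≢k : q ≢ k) where

  step12-into : ∀ u → S u → step12 k R u p ≡ step12 k R u q
  step12-into u Su with u ≟ k | p ≟ k | q ≟ k
  ... | _     | yes p≡k | _       = ⊥-elim (p≢k p≡k)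
  ... | _     | no _    | yes q≡k = ⊥-elim (q≢k q≡k)
  ... | yes _ | no _    | no _    = proj₂ (tw u Su)
  ... | no _  | no _    | no _    =
    cong₂ (λ m l → m + R u k * l) (proj₁ (tw u Su)) (proj₁ (tw k Sk))

  step12-out : ∀ u → S u → step12 k R p u ≡ step12 k R q u
  step12-out u Su with u ≟ k | p ≟ k | q ≟ k
  ... | _     | yes p≡k | _       = ⊥-elim (p≢k p≡k)
  ... | _     | no _    | yes q≡k = ⊥-elim (q≢k q≡k)
  ... | yes _ | no _    | no _    = proj₁ (tw u Su)
  ... | no _  | no _    | no _    =
    cong₂ (λ m l → m + l * R k u) (proj₂ (tw u Su)) (proj₂ (tw k Sk))

  mutate-twins : Twins S (mutate k R) p q
  mutate-twins u Su =
    cong₂ _∸_ (step12-into u Su) (step12-out u Su) ,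
    cong₂ _∸_ (step12-out u Su) (step12-into u Su)

mutateSeq-twins : ∀ {n} {S : Fin n → Set} {p q : Fin n} (R : Arrows n) (ks : List (Fin n)) →
  Avoids S p q → All S ks → Twins S R p q → Twins S (mutateSeq ks R) p q
mutateSeq-twins R _        _     []         tw = tw
mutateSeq-twins R (k ∷ ks) avoid (Sk ∷ Sks) tw =
  mutateSeq-twins (mutate k R) ks avoid Sks
    (mutate-twins tw Sk (proj₁ (avoid k Sk)) (proj₂ (avoid k Sk)))

WithFrozen : ∀ {N} → (Fin N → Set) → Fin (N + N) → Set
WithFrozen {N} S w = Σ (Fin N) λ u → S u × ((w ≡ u ↑ˡ N) ⊎ (w ≡ N ↑ʳ u))

module _ {N : ℕ} {S : Fin N → Set} {p q : Fin N} (avoid : Avoids S p q) where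

  withFrozen-avoids : Avoids (WithFrozen S) (p ↑ˡ N) (q ↑ˡ N)
  withFrozen-avoids _ (u , Su , inj₁ refl) =
    (λ e → proj₁ (avoid u Su) (↑ˡ-injective N p u e)) ,
    (λ e → proj₂ (avoid u Su) (↑ˡ-injective N q u e))
  withFrozen-avoids _ (u , Su , inj₂ refl) = ↑ˡ≢↑ʳ p u , ↑ˡ≢↑ʳ q u

  framed-twins : (Q : Arrows N) → Twins S Q p q → Twins (WithFrozen S) (framed Q) (p ↑ˡ N) (q ↑ˡ N)
  framed-twins Q tw _ (u , Su , inj₁ refl) =
    trans (framed-↑ˡ-↑ˡ Q u p) (trans (proj₁ (tw u Su)) (sym (framed-↑ˡ-↑ˡ Q u q))) ,
    trans (framed-↑ˡ-↑ˡ Q p u) (trans (proj₂ (tw u Su)) (sym (framed-↑ˡ-↑ˡ Q q u)))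
  framed-twins Q tw _ (u , Su , inj₂ refl) =
    trans (framed-↑ʳ Q u _) (sym (framed-↑ʳ Q u _)) ,
    trans (framed-↑ˡ-↑ʳ Q p u (proj₁ (avoid u Su))) (sym (framed-↑ˡ-↑ʳ Q q u (proj₂ (avoid u Su))))

LeftVertex : ∀ {N₁} N₂ → Fin (N₁ + N₂) → Set
LeftVertex {N₁} N₂ w = Σ (Fin N₁) λ y → w ≡ y ↑ˡ N₂

-- In Q₁ ⊕_{(a,…,a)}^{(b₁,…,b_r)} Q₂ with b injective, all b_i are twins
-- relative to Q₁: each receives exactly ⌊ a ≟ y ⌋ arrows from y ∈ Q₁ and
-- sends none back.
module _ {N₁ N₂ r : ℕ} (Q₁ : Arrows N₁) (Q₂ : Arrows N₂)
         (a : Fin N₁) (b : Fin r → Fin N₂) (inj : Injective _≡_ _≡_ b) where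

  directSum-in : ∀ y i →
    directSum Q₁ Q₂ (λ _ → a) b (y ↑ˡ N₂) (N₁ ↑ʳ b i) ≡ (if ⌊ a ≟ y ⌋ then 1 else 0)
  directSum-in y i =
    trans (directSum-↑ˡ-↑ʳ Q₁ Q₂ (λ _ → a) b y (b i))
      (trans (countFin-∧ ⌊ a ≟ y ⌋ (λ t → ⌊ b t ≟ b i ⌋))
        (cong (λ m → if ⌊ a ≟ y ⌋ then m else 0) (countFin-injective b inj i)))

  directSum-twins : ∀ i j →
    Twins (LeftVertex N₂) (directSum Q₁ Q₂ (λ _ → a) b) (N₁ ↑ʳ b i) (N₁ ↑ʳ b j)
  directSum-twins i j _ (y , refl) =
    trans (directSum-in y i) (sym (directSum-in y j)) ,
    trans (directSum-↑ʳ-↑ˡ Q₁ Q₂ _ b (b i) y) (sym (directSum-↑ʳ-↑ˡ Q₁ Q₂ _ b (b j) y))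

leftVertex-avoids : ∀ {N₁ N₂} (c d : Fin N₂) → Avoids (LeftVertex {N₁} N₂) (N₁ ↑ʳ c) (N₁ ↑ʳ d)
leftVertex-avoids c d _ (y , refl) = (λ e → ↑ˡ≢↑ʳ y c (sym e)) , (λ e → ↑ˡ≢↑ʳ y d (sym e))

lemma3p6 : (N₁ N₂ r : ℕ) (Q₁ : Arrows N₁) (Q₂ : Arrows N₂) →
    IsQuiver Q₁ → IsQuiver Q₂ →
    (a : Fin N₁) (b : Fin r → Fin N₂) → Injective _≡_ _≡_ b →
    (μs : List (Fin N₁)) (k : ℕ) → k ≤ length μs →
    (x : Fin N₁) (i j : Fin r) →
    let N = N₁ + N₂
        Q = directSum Q₁ Q₂ (λ _ → a) b
        μk = map (λ v → v ↑ˡ N₂) (take k μs)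
        Qk = mutateSeq (map (λ v → v ↑ˡ N) μk) (framed Q)
        vx = (x ↑ˡ N₂) ↑ˡ N
    in α Qk vx ((N₁ ↑ʳ b i) ↑ˡ N) ≡ α Qk vx ((N₁ ↑ʳ b j) ↑ˡ N)
lemma3p6 N₁ N₂ r Q₁ Q₂ _ _ a b inj μs k _ x i j =
  twins-α {R = Qk} twins-after-mutation ((x ↑ˡ N₂) ↑ˡ N) (in-S x)
  where
  N : ℕ
  N = N₁ + N₂
  Q : Arrows N
  Q = directSum Q₁ Q₂ (λ _ → a) b
  p q : Fin N
  p = N₁ ↑ʳ b i
  q = N₁ ↑ʳ b j
  S : Fin (N + N) → Set
  S = WithFrozen (LeftVertex {N₁} N₂)
  in-S : ∀ y → S ((y ↑ˡ N₂) ↑ˡ N)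
  in-S y = y ↑ˡ N₂ , (y , refl) , inj₁ refl
  avoid : Avoids (LeftVertex {N₁} N₂) p q
  avoid = leftVertex-avoids {N₁} (b i) (b j)
  Qk : Arrows (N + N)
  Qk = mutateSeq (map (λ v → v ↑ˡ N) (map (λ v → v ↑ˡ N₂) (take k μs))) (framed Q)
  twins-after-mutation : Twins S Qk (p ↑ˡ N) (q ↑ˡ N)
  twins-after-mutation =
    mutateSeq-twins (framed Q) _ (withFrozen-avoids avoid)
      (map⁺ (map⁺ (universal in-S (take k μs))))
      (framed-twins avoid Q (directSum-twins Q₁ Q₂ a b inj i j))
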